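{- Let $k\ge2$ and $n\in\mathbb{N}$. If $w,w'\in S_n$ satisfy $(c_w)_i\le (c_{w'})_i$ for all $i\in[n]$, then $I(k,n,w)\le I(k,n,w')$.
   Context: The infinite rooted directed $k$-ary tree has a root on layer $1$; every vertex has $k$ children, ordered left to right, on the next layer. A vertex with at least $k$ chips may fire by choosing $k$ of its labeled chips and sending the $j$th smallest to its $j$th leftmost child. Chips $0,\dots,k^n-1$ start at the root and are written in $n$-digit $k$-ary expansion. For $w\in S_n$, the strategy $F_w$ fires, for each $i\in[n]$, each vertex $v$ on layer $i$ so that all chips on $v$ whose $w_i$th most significant digit equals $j$ go to the $(j+1)$th leftmost child of $v$. $\mathcal{C}_{k,n,w}$ is the resulting stable configuration, read as the sequence of chips on layer $n+1$ from left to right, and $I(k,n,w)$ is its number of inversions. The Lehmer code of $w$ is $c_w$ with $(c_w)_i=\#\{j>i: w_j<w_i\}$. -}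

module Defs where

open import Data.Nat using (ℕ; zero; suc; _∸_; _^_; _<_; _≟_; _<?_)
import Data.Nat.DivMod
open import Data.Nat.DivMod using (_/_; _%_)
open import Data.Nat.Properties using (m^n≢0)
open import Data.Fin using (Fin; toℕ) renaming (_<_ to _<ᶠ_; _<?_ to _<ᶠ?_)
open import Data.Fin.Permutation using (Permutation′; _⟨$⟩ʳ_)
open import Data.List using (List; []; _∷_; length; filter; map; concat; concatMap; upTo; allFin; foldl)
open import Relation.Nullary.Decidable using (_×-dec_)

-- m-th most significant digit (0-indexed: m = 0 is the most significant)
-- of x written with n digits in base k.  (k = 0 is meaningless; return 0.)
digit : (k n m x : ℕ) → ℕ
digit zero    n m x = 0
digit (suc k) n m x = (Data.Nat.DivMod._/_ x (suc k ^ (n ∸ suc m)) {{m^n≢0 (suc k) (n ∸ suc m)}}) % suc k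

-- A configuration on one layer: list of vertices left to right, each
-- holding a list of (labelled) chips.
Layer : Set
Layer = List (List ℕ)

-- Fire every vertex of a layer, sending chips whose m-th most significant
-- digit equals j to the (j+1)-th leftmost child (children of a vertex are
-- listed left to right; vertices of the next layer are ordered left to right).
fireLayer : (k n m : ℕ) → Layer → Layer
fireLayer k n m = concatMap (λ cs → map (λ j → filter (λ x → digit k n m x ≟ j) cs) (upTo k))

-- Strategy F_w : for i = 1..n fire layer i using digit w_i.
-- (Indices are 0-based: layer i+1 uses the permutation value w ⟨$⟩ʳ i.)
finalLayer : (k n : ℕ) → Permutation′ n → Layer
finalLayer k n w = foldl (λ L i → fireLayer k n (toℕ (w ⟨$⟩ʳ i)) L) ((upTo (k ^ n)) ∷ []) (allFin n)

config : (k n : ℕ) → Permutation′ n → List ℕ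
config k n w = concat (finalLayer k n w)

inversions : List ℕ → ℕ
inversions []       = 0
inversions (x ∷ xs) = length (filter (λ y → y <? x) xs) + inversions xs
  where open import Data.Nat using (_+_)

I : (k n : ℕ) → Permutation′ n → ℕ
I k n w = inversions (config k n w)

lehmer : {n : ℕ} → Permutation′ n → Fin n → ℕ
lehmer {n} w i = length (filter (λ j → (i <ᶠ? j) ×-dec ((w ⟨$⟩ʳ j) <ᶠ? (w ⟨$⟩ʳ i))) (allFin n))

{-# OPTIONS --safe #-}

-- Identify each chip with the word of its n base-k digits, most significant first; the chips
-- 0, …, kⁿ−1 are then the words in lexicographic order.  Under F_w the first firing splits the
-- words by their digit at position m = w₁ into k blocks, the block for digit f consisting of the
-- words of length n−1 with f inserted at position m; afterwards F_w acts on every block exactly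
-- as F_w′ acts on words of length n−1, where w′ is w with w₁ removed, and c_w′ is the tail of c_w.
-- Inserting a fixed digit preserves the order of words, so
--   I(k, n, w) = k · I(k, n−1, w′) + X(n−1, m),
-- where X(n−1, m) counts the inversions between different blocks and depends only on
-- m = (c_w)₁ (0-based).  X(n, 0) = 0, since then the blocks concatenate to the sorted list,
-- and X(n+1, m+1) = k · X(n, m) + (k choose 2) · (a term independent of m), because the blocks
-- for position m+1 are k shifted copies of the blocks for position m.  So X is monotone in m,
-- and induction on n proves the theorem.

module Submission where

open import Defs
open import Data.Bool using (true; false; if_then_else_)
open import Data.Fin using (Fin; toℕ; punchIn) renaming (_<_ to _<ᶠ_; _<?_ to _<ᶠ?_)
open import Data.Fin.Permutation using (Permutation′; _⟨$⟩ʳ_; remove; punchIn-permute)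
open import Data.Fin.Properties using (toℕ<n; toℕ-injective; punchIn-mono-≤; punchIn-cancel-≤)
import Data.Fin.Properties as Finₚ
open import Data.List using (List; []; _∷_; _++_; length; filter; map; concat; concatMap; upTo; allFin; foldl)
open import Data.List.Properties hiding (sum-++)
open import Data.List.Relation.Binary.Permutation.Propositional
  using (_↭_; ↭-refl; ↭-trans; ↭-reflexive; prep; module PermutationReasoning)
open import Data.List.Relation.Binary.Permutation.Propositional.Properties using (filter-↭; map⁺; ↭-length; ++⁺; shift)
open import Data.List.Relation.Unary.All as All using (All; []; _∷_)
open import Data.List.Relation.Unary.All.Properties as All using ()
open import Data.Nat using (ℕ; zero; suc; _+_; _*_; _∸_; _^_; _≤_; _<_; z≤n; s≤s; s≤s⁻¹; _<?_; _≟_; NonZero)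
open import Data.Nat.Combinatorics using (_C_; nC1≡n; nCk+nC[k+1]≡[n+1]C[k+1])
open import Data.Nat.DivMod using (_/_; _%_; m*n/n≡m; +-distrib-/-∣ˡ; m<n⇒m/n≡0; m<n⇒m%n≡m; [m+kn]%n≡m%n)
open import Data.Nat.Divisibility using (divides-refl)
open import Data.Nat.ListAction using (sum)
open import Data.Nat.ListAction.Properties using (sum-++; sum-↭)
open import Data.Nat.Properties
open import Algebra.Properties.CommutativeMonoid.Sum +-0-commutativeMonoid using (sum-syntax; ∑-permute; sum-replicate-zero)
open import Algebra.Properties.CommutativeSemigroup +-commutativeSemigroup using (interchange)
open import Data.Nat.Tactic.RingSolver using (solve-∀)
open import Data.Product using (_×_; _,_; proj₂)
open import Data.Product.Function.NonDependent.Propositional using (_×-⇔_)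
open import Data.Sum using (_⊎_; inj₁; inj₂)
open import Data.Sum.Function.Propositional using (_⊎-⇔_)
open import Data.Vec using (Vec; []; _∷_; lookup; insertAt)
open import Data.Vec.Properties using (insertAt-punchIn)
open import Function using (_∘_; _⇔_; mk⇔; Equivalence)
import Function.Properties.Equivalence as ⇔
open import Level using (0ℓ)
open import Relation.Binary.Definitions using (tri<; tri≈; tri>)
open import Relation.Binary.PropositionalEquality
open import Relation.Nullary using (Dec; does; contradiction)
open import Relation.Nullary.Decidable using (_×-dec_)
open import Relation.Unary using (Pred; Decidable)

private variable
  X Y : Set

filter-map : ∀ {P : Pred Y 0ℓ} (P? : Decidable P) (f : X → Y) xs → filter P? (map f xs) ≡ map f (filter (P? ∘ f) xs)
filter-map P? f []       = refl
filter-map P? f (x ∷ xs) with does (P? (f x))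
... | true  = cong (f x ∷_) (filter-map P? f xs)
... | false = filter-map P? f xs

length-filter-map : ∀ {P : Pred Y 0ℓ} (P? : Decidable P) (f : X → Y) xs →
  length (filter P? (map f xs)) ≡ length (filter (P? ∘ f) xs)
length-filter-map P? f xs = trans (cong length (filter-map P? f xs)) (length-map f (filter (P? ∘ f) xs))

filter-concatMap : ∀ {P : Pred Y 0ℓ} (P? : Decidable P) (g : X → List Y) xs →
  filter P? (concatMap g xs) ≡ concatMap (filter P? ∘ g) xs
filter-concatMap P? g []       = refl
filter-concatMap P? g (x ∷ xs) = trans (filter-++ P? (g x) (concatMap g xs)) (cong (filter P? (g x) ++_) (filter-concatMap P? g xs))

upTo-suc : ∀ n → upTo (suc n) ≡ 0 ∷ map suc (upTo n)
upTo-suc n = cong (0 ∷_) (sym (map-upTo suc n))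

upTo-+ : ∀ m n → upTo (m + n) ≡ upTo m ++ map (m +_) (upTo n)
upTo-+ zero    n = sym (map-id (upTo n))
upTo-+ (suc m) n = begin
  upTo (suc (m + n))
    ≡⟨ upTo-suc (m + n) ⟩
  0 ∷ map suc (upTo (m + n))
    ≡⟨ cong (λ l → 0 ∷ map suc l) (upTo-+ m n) ⟩
  0 ∷ map suc (upTo m ++ map (m +_) (upTo n))
    ≡⟨ cong (0 ∷_) (map-++ suc (upTo m) _) ⟩
  0 ∷ map suc (upTo m) ++ map suc (map (m +_) (upTo n))
    ≡⟨ cong (λ l → 0 ∷ map suc (upTo m) ++ l) (map-∘ (upTo n)) ⟨
  0 ∷ map suc (upTo m) ++ map (suc m +_) (upTo n)
    ≡⟨ cong (_++ map (suc m +_) (upTo n)) (upTo-suc m) ⟨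
  upTo (suc m) ++ map (suc m +_) (upTo n) ∎
  where open ≡-Reasoning

allFin-suc : ∀ n → allFin (suc n) ≡ Fin.zero ∷ map Fin.suc (allFin n)
allFin-suc n = cong (Fin.zero ∷_) (sym (map-tabulate (λ i → i) Fin.suc))

map-toℕ-allFin : ∀ n → map toℕ (allFin n) ≡ upTo n
map-toℕ-allFin zero    = refl
map-toℕ-allFin (suc n) = begin
  map toℕ (allFin (suc n))                  ≡⟨ cong (map toℕ) (allFin-suc n) ⟩
  0 ∷ map toℕ (map Fin.suc (allFin n))      ≡⟨ cong (0 ∷_) (map-∘ (allFin n)) ⟨
  0 ∷ map (suc ∘ toℕ) (allFin n)            ≡⟨ cong (0 ∷_) (map-∘ (allFin n)) ⟩
  0 ∷ map suc (map toℕ (allFin n))          ≡⟨ cong (λ l → 0 ∷ map suc l) (map-toℕ-allFin n) ⟩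
  0 ∷ map suc (upTo n)                      ≡⟨ upTo-suc n ⟨
  upTo (suc n)                              ∎
  where open ≡-Reasoning

concatMap-allFin-single : ∀ {n} (g : Fin n → List X) f → (∀ d → d ≢ f → g d ≡ []) → concatMap g (allFin n) ≡ g f
concatMap-allFin-single {n = suc n} g f others≡[] = trans
  (cong (concatMap g) (allFin-suc n))
  (trans (cong (g Fin.zero ++_) (concatMap-map g Fin.suc (allFin n))) (select f others≡[]))
  where
  select : ∀ f → (∀ d → d ≢ f → g d ≡ []) → g Fin.zero ++ concatMap (g ∘ Fin.suc) (allFin n) ≡ g f
  select Fin.zero    others≡[] = trans (cong (g Fin.zero ++_) (concatMap-[] (allFin n))) (++-identityʳ (g Fin.zero))
    where
    concatMap-[] : ∀ ds → concatMap (g ∘ Fin.suc) ds ≡ []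
    concatMap-[] []       = refl
    concatMap-[] (d ∷ ds) = cong₂ _++_ (others≡[] (Fin.suc d) λ ()) (concatMap-[] ds)
  select (Fin.suc f) others≡[] = cong₂ _++_ (others≡[] Fin.zero λ ())
    (concatMap-allFin-single (g ∘ Fin.suc) f (λ d d≢f → others≡[] (Fin.suc d) (d≢f ∘ Finₚ.suc-injective)))

sum-map-const : ∀ c (xs : List X) → sum (map (λ _ → c) xs) ≡ length xs * c
sum-map-const c []       = refl
sum-map-const c (x ∷ xs) = cong (c +_) (sum-map-const c xs)

-- Inversions

smallerThan : ℕ → List ℕ → ℕ
smallerThan a B = length (filter (_<? a) B)

crossInversions : List ℕ → List ℕ → ℕ
crossInversions A B = sum (map (λ a → smallerThan a B) A)

smallerThan-++ : ∀ a B B′ → smallerThan a (B ++ B′) ≡ smallerThan a B + smallerThan a B′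
smallerThan-++ a B B′ = trans (cong length (filter-++ (_<? a) B B′)) (length-++ (filter (_<? a) B))

crossInversions-++ˡ : ∀ A A′ B → crossInversions (A ++ A′) B ≡ crossInversions A B + crossInversions A′ B
crossInversions-++ˡ A A′ B = trans (cong sum (map-++ _ A A′)) (sum-++ (map _ A) _)

crossInversions-++ʳ : ∀ A B B′ → crossInversions A (B ++ B′) ≡ crossInversions A B + crossInversions A B′
crossInversions-++ʳ []      B B′ = refl
crossInversions-++ʳ (a ∷ A) B B′
  rewrite smallerThan-++ a B B′ | crossInversions-++ʳ A B B′ =
  interchange (smallerThan a B) (smallerThan a B′) (crossInversions A B) (crossInversions A B′)

inversions-++ : ∀ A B → inversions (A ++ B) ≡ inversions A + inversions B + crossInversions A B
inversions-++ []      B = sym (+-identityʳ (inversions B))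
inversions-++ (a ∷ A) B
  rewrite smallerThan-++ a A B | inversions-++ A B =
  rearrange (smallerThan a A) (smallerThan a B) (inversions A) (inversions B) (crossInversions A B)
  where
  rearrange : ∀ a b c d e → a + b + (c + d + e) ≡ a + c + d + (b + e)
  rearrange = solve-∀

crossInversions-↭ˡ : ∀ {A A′} B → A ↭ A′ → crossInversions A B ≡ crossInversions A′ B
crossInversions-↭ˡ B p = sum-↭ (map⁺ _ p)

crossInversions-↭ʳ : ∀ A {B B′} → B ↭ B′ → crossInversions A B ≡ crossInversions A B′
crossInversions-↭ʳ A p = cong sum (map-cong (λ a → ↭-length (filter-↭ (_<? a) p)) A)

crossInversions-[]ʳ : ∀ A → crossInversions A [] ≡ 0
crossInversions-[]ʳ []      = refl
crossInversions-[]ʳ (a ∷ A) = crossInversions-[]ʳ A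

smallerThan-all : ∀ {a B} → All (_< a) B → smallerThan a B ≡ length B
smallerThan-all {a} B<a = cong length (filter-all (_<? a) B<a)

smallerThan-none : ∀ {a B} → All (a ≤_) B → smallerThan a B ≡ 0
smallerThan-none {a} a≤B = cong length (filter-none (_<? a) (All.map ≤⇒≯ a≤B))

SameOrder : (X → ℕ) → (X → ℕ) → Set
SameOrder g h = ∀ a b → g a < g b ⇔ h a < h b

smallerThan-sameOrder : ∀ {g h : X → ℕ} → SameOrder g h → ∀ a B →
  smallerThan (g a) (map g B) ≡ smallerThan (h a) (map h B)
smallerThan-sameOrder {g = g} {h} same a B = begin
  length (filter (_<? g a) (map g B))
    ≡⟨ length-filter-map (_<? g a) g B ⟩
  length (filter (λ b → g b <? g a) B)
    ≡⟨ cong length (filter-≐ _ _ (Equivalence.to (same _ a) , Equivalence.from (same _ a)) B) ⟩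
  length (filter (λ b → h b <? h a) B)
    ≡⟨ length-filter-map (_<? h a) h B ⟨
  length (filter (_<? h a) (map h B)) ∎
  where open ≡-Reasoning

inversions-sameOrder : ∀ {g h : X → ℕ} → SameOrder g h → ∀ B → inversions (map g B) ≡ inversions (map h B)
inversions-sameOrder same []      = refl
inversions-sameOrder same (b ∷ B) = cong₂ _+_ (smallerThan-sameOrder same b B) (inversions-sameOrder same B)

crossInversions-sameOrder : ∀ {g h : X → ℕ} → SameOrder g h → ∀ A B →
  crossInversions (map g A) (map g B) ≡ crossInversions (map h A) (map h B)
crossInversions-sameOrder same []      B = refl
crossInversions-sameOrder same (a ∷ A) B = cong₂ _+_ (smallerThan-sameOrder same a B) (crossInversions-sameOrder same A B)

inversions-upTo : ∀ n → inversions (upTo n) ≡ 0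
inversions-upTo zero    = refl
inversions-upTo (suc n) = begin
  inversions (upTo (suc n))
    ≡⟨ cong inversions (upTo-suc n) ⟩
  smallerThan 0 (map suc (upTo n)) + inversions (map suc (upTo n))
    ≡⟨ cong₂ _+_ (smallerThan-none (All.universal (λ _ → z≤n) (map suc (upTo n))))
                 (inversions-sameOrder suc-sameOrder (upTo n)) ⟩
  inversions (map (λ x → x) (upTo n))
    ≡⟨ cong inversions (map-id (upTo n)) ⟩
  inversions (upTo n)
    ≡⟨ inversions-upTo n ⟩
  0 ∎
  where
  open ≡-Reasoning
  suc-sameOrder : SameOrder suc (λ x → x)
  suc-sameOrder a b = mk⇔ s≤s⁻¹ s≤s

blockCrossings : List (List ℕ) → ℕ
blockCrossings []       = 0
blockCrossings (B ∷ Bs) = crossInversions B (concat Bs) + blockCrossings Bs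

inversions-concat : ∀ Bs → inversions (concat Bs) ≡ sum (map inversions Bs) + blockCrossings Bs
inversions-concat []       = refl
inversions-concat (B ∷ Bs) rewrite inversions-++ B (concat Bs) | inversions-concat Bs =
  rearrange (inversions B) (sum (map inversions Bs)) (blockCrossings Bs) (crossInversions B (concat Bs))
  where
  rearrange : ∀ a b c d → a + (b + c) + d ≡ a + b + (d + c)
  rearrange = solve-∀

concat-map-↭ : ∀ {F G : X → List Y} → (∀ x → F x ↭ G x) → ∀ xs → concat (map F xs) ↭ concat (map G xs)
concat-map-↭ F↭G []       = ↭-refl
concat-map-↭ F↭G (x ∷ xs) = ++⁺ (F↭G x) (concat-map-↭ F↭G xs)

blockCrossings-cong-↭ : ∀ {F G : X → List ℕ} → (∀ x → F x ↭ G x) → ∀ xs →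
  blockCrossings (map F xs) ≡ blockCrossings (map G xs)
blockCrossings-cong-↭ F↭G []       = refl
blockCrossings-cong-↭ {F = F} {G} F↭G (x ∷ xs) = cong₂ _+_
  (trans (crossInversions-↭ˡ (concat (map F xs)) (F↭G x)) (crossInversions-↭ʳ (G x) (concat-map-↭ F↭G xs)))
  (blockCrossings-cong-↭ F↭G xs)

-- Shifted copies of a list

shiftedCopies : ℕ → ℕ → List ℕ → List ℕ
shiftedCopies K a A = concatMap (λ d → map (d * K +_) A) (upTo a)

shiftedCopies-suc : ∀ K a A → shiftedCopies K (suc a) A ≡ A ++ map (K +_) (shiftedCopies K a A)
shiftedCopies-suc K a A = begin
  concatMap copy (upTo (suc a))                       ≡⟨ cong (concatMap copy) (upTo-suc a) ⟩
  map (λ x → x) A ++ concatMap copy (map suc (upTo a)) ≡⟨ cong₂ _++_ (map-id A) (concatMap-map copy suc (upTo a)) ⟩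
  A ++ concatMap (copy ∘ suc) (upTo a)                 ≡⟨ cong (A ++_) (concatMap-cong shift-copy (upTo a)) ⟩
  A ++ concatMap (map (K +_) ∘ copy) (upTo a)          ≡⟨ cong (A ++_) (map-concatMap (K +_) copy (upTo a)) ⟨
  A ++ map (K +_) (shiftedCopies K a A)                ∎
  where
  open ≡-Reasoning
  copy : ℕ → List ℕ
  copy d = map (d * K +_) A
  shift-copy : ∀ d → copy (suc d) ≡ map (K +_) (copy d)
  shift-copy d = trans (map-cong (+-assoc K (d * K)) A) (map-∘ A)

length-shiftedCopies : ∀ K a A → length (shiftedCopies K a A) ≡ a * length A
length-shiftedCopies K zero    A = refl
length-shiftedCopies K (suc a) A = begin
  length (shiftedCopies K (suc a) A)             ≡⟨ cong length (shiftedCopies-suc K a A) ⟩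
  length (A ++ map (K +_) (shiftedCopies K a A)) ≡⟨ length-++ A ⟩
  length A + length (map (K +_) (shiftedCopies K a A)) ≡⟨ cong (length A +_) (length-map (K +_) (shiftedCopies K a A)) ⟩
  length A + length (shiftedCopies K a A)        ≡⟨ cong (length A +_) (length-shiftedCopies K a A) ⟩
  length A + a * length A                        ∎
  where open ≡-Reasoning

upTo-* : ∀ a K → upTo (a * K) ≡ shiftedCopies K a (upTo K)
upTo-* zero    K = refl
upTo-* (suc a) K = begin
  upTo (K + a * K)                               ≡⟨ upTo-+ K (a * K) ⟩
  upTo K ++ map (K +_) (upTo (a * K))            ≡⟨ cong (λ l → upTo K ++ map (K +_) l) (upTo-* a K) ⟩
  upTo K ++ map (K +_) (shiftedCopies K a (upTo K)) ≡⟨ shiftedCopies-suc K a (upTo K) ⟨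
  shiftedCopies K (suc a) (upTo K)               ∎
  where open ≡-Reasoning

crossInversions-shiftedʳ : ∀ K {A} X → All (_< K) A → crossInversions A (map (K +_) X) ≡ 0
crossInversions-shiftedʳ K X []         = refl
crossInversions-shiftedʳ K X (a<K ∷ A<K) = cong₂ _+_
  (smallerThan-none (All.map⁺ (All.universal (λ x → ≤-trans (<⇒≤ a<K) (m≤m+n K x)) X)))
  (crossInversions-shiftedʳ K X A<K)

crossInversions-shiftedˡ : ∀ K X {B} → All (_< K) B → crossInversions (map (K +_) X) B ≡ length X * length B
crossInversions-shiftedˡ K []      B<K = refl
crossInversions-shiftedˡ K (x ∷ X) B<K = cong₂ _+_
  (smallerThan-all (All.map (λ b<K → <-≤-trans b<K (m≤m+n K x)) B<K))
  (crossInversions-shiftedˡ K X B<K)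

crossInversions-shifted : ∀ K X Y → crossInversions (map (K +_) X) (map (K +_) Y) ≡ crossInversions X Y
crossInversions-shifted K X Y = begin
  crossInversions (map (K +_) X) (map (K +_) Y)       ≡⟨ crossInversions-sameOrder shift-sameOrder X Y ⟩
  crossInversions (map (λ x → x) X) (map (λ x → x) Y) ≡⟨ cong₂ crossInversions (map-id X) (map-id Y) ⟩
  crossInversions X Y                                 ∎
  where
  open ≡-Reasoning
  shift-sameOrder : SameOrder (K +_) (λ x → x)
  shift-sameOrder a b = mk⇔ (+-cancelˡ-< K a b) (+-monoʳ-< K)

[1+n]C2≡n+nC2 : ∀ a → suc a C 2 ≡ a + a C 2
[1+n]C2≡n+nC2 a = trans (sym (nCk+nC[k+1]≡[n+1]C[k+1] a 1)) (cong (_+ a C 2) (nC1≡n a))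

crossInversions-shiftedCopies : ∀ K a {A B} → All (_< K) A → All (_< K) B →
  crossInversions (shiftedCopies K a A) (shiftedCopies K a B) ≡ a * crossInversions A B + (a C 2) * (length A * length B)
crossInversions-shiftedCopies K zero    A<K B<K = refl
crossInversions-shiftedCopies K (suc a) {A} {B} A<K B<K = begin
  crossInversions (shiftedCopies K (suc a) A) (shiftedCopies K (suc a) B)
    ≡⟨ cong₂ crossInversions (shiftedCopies-suc K a A) (shiftedCopies-suc K a B) ⟩
  crossInversions (A ++ map (K +_) SA) (B ++ map (K +_) SB)
    ≡⟨ crossInversions-++ˡ A (map (K +_) SA) (B ++ map (K +_) SB) ⟩
  crossInversions A (B ++ map (K +_) SB) + crossInversions (map (K +_) SA) (B ++ map (K +_) SB)
    ≡⟨ cong₂ _+_ (crossInversions-++ʳ A B (map (K +_) SB)) (crossInversions-++ʳ (map (K +_) SA) B (map (K +_) SB)) ⟩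
  (crossInversions A B + crossInversions A (map (K +_) SB))
    + (crossInversions (map (K +_) SA) B + crossInversions (map (K +_) SA) (map (K +_) SB))
    ≡⟨ cong₂ _+_ (cong (crossInversions A B +_) (crossInversions-shiftedʳ K SB A<K))
                 (cong₂ _+_ (crossInversions-shiftedˡ K SA B<K) (crossInversions-shifted K SA SB)) ⟩
  (crossInversions A B + 0) + (length SA * length B + crossInversions SA SB)
    ≡⟨ cong₂ (λ l c → (crossInversions A B + 0) + (l * length B + c))
             (length-shiftedCopies K a A) (crossInversions-shiftedCopies K a A<K B<K) ⟩
  (crossInversions A B + 0) + (a * length A * length B + (a * crossInversions A B + (a C 2) * (length A * length B)))
    ≡⟨ rearrange (crossInversions A B) a (a C 2) (length A) (length B) ⟩
  suc a * crossInversions A B + (a + a C 2) * (length A * length B)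
    ≡⟨ cong (λ c → suc a * crossInversions A B + c * (length A * length B)) ([1+n]C2≡n+nC2 a) ⟨
  suc a * crossInversions A B + (suc a C 2) * (length A * length B)
    ∎
  where
  open ≡-Reasoning
  SA = shiftedCopies K a A
  SB = shiftedCopies K a B
  rearrange : ∀ x a c l m → (x + 0) + (a * l * m + (a * x + c * (l * m))) ≡ suc a * x + (a + c) * (l * m)
  rearrange = solve-∀

blockPairs : List ℕ → ℕ
blockPairs []       = 0
blockPairs (l ∷ ls) = l * sum ls + blockPairs ls

blockCrossings-shiftedCopies : ∀ K a Bs → All (All (_< K)) Bs →
  blockCrossings (map (shiftedCopies K a) Bs) ≡ a * blockCrossings Bs + (a C 2) * blockPairs (map length Bs)
blockCrossings-shiftedCopies K a []       []           = sym (cong₂ _+_ (*-zeroʳ a) (*-zeroʳ (a C 2)))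
blockCrossings-shiftedCopies K a (B ∷ Bs) (B<K ∷ Bs<K) = trans
  (cong₂ _+_ (crossInversions-concat Bs Bs<K) (blockCrossings-shiftedCopies K a Bs Bs<K))
  (linear a (a C 2) _ _ _ _)
  where
  linear : ∀ a c x y z w → (a * x + c * y) + (a * z + c * w) ≡ a * (x + z) + c * (y + w)
  linear = solve-∀
  crossInversions-concat : ∀ Ds → All (All (_< K)) Ds →
    crossInversions (shiftedCopies K a B) (concat (map (shiftedCopies K a) Ds))
      ≡ a * crossInversions B (concat Ds) + (a C 2) * (length B * sum (map length Ds))
  crossInversions-concat []       []
    rewrite crossInversions-[]ʳ (shiftedCopies K a B) | crossInversions-[]ʳ B | *-zeroʳ (length B)
    = sym (cong₂ _+_ (*-zeroʳ a) (*-zeroʳ (a C 2)))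
  crossInversions-concat (D ∷ Ds) (D<K ∷ Ds<K) = begin
    crossInversions (shiftedCopies K a B) (shiftedCopies K a D ++ concat (map (shiftedCopies K a) Ds))
      ≡⟨ crossInversions-++ʳ (shiftedCopies K a B) (shiftedCopies K a D) (concat (map (shiftedCopies K a) Ds)) ⟩
    crossInversions (shiftedCopies K a B) (shiftedCopies K a D)
      + crossInversions (shiftedCopies K a B) (concat (map (shiftedCopies K a) Ds))
      ≡⟨ cong₂ _+_ (crossInversions-shiftedCopies K a B<K D<K) (crossInversions-concat Ds Ds<K) ⟩
    (a * crossInversions B D + (a C 2) * (length B * length D))
      + (a * crossInversions B (concat Ds) + (a C 2) * (length B * sum (map length Ds)))
      ≡⟨ linear a (a C 2) _ _ _ _ ⟩
    a * (crossInversions B D + crossInversions B (concat Ds)) + (a C 2) * (length B * length D + length B * sum (map length Ds))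
      ≡⟨ cong₂ (λ x y → a * x + (a C 2) * y)
               (crossInversions-++ʳ B D (concat Ds)) (*-distribˡ-+ (length B) (length D) (sum (map length Ds))) ⟨
    a * crossInversions B (D ++ concat Ds) + (a C 2) * (length B * (length D + sum (map length Ds))) ∎
    where open ≡-Reasoning

-- Chip firing

-- `fireLayer k n m` is `fire k (digit k n m)` and `finalLayer` is a `fireAll`, both by definition.
fire : ℕ → (X → ℕ) → List (List X) → List (List X)
fire k key = concatMap (λ cs → map (λ j → filter (λ x → key x ≟ j) cs) (upTo k))

fireAll : {I : Set} → ℕ → (I → X → ℕ) → List (List X) → List I → List (List X)
fireAll k key = foldl (λ L i → fire k (key i) L)

fire-map : ∀ k {key : Y → ℕ} {key′ : X → ℕ} (h : X → Y) → (∀ x → key (h x) ≡ key′ x) →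
  ∀ L → fire k key (map (map h) L) ≡ map (map h) (fire k key′ L)
fire-map k {key} {key′} h key∘h≡key′ L = begin
  concatMap (children key) (map (map h) L)       ≡⟨ concatMap-map (children key) (map h) L ⟩
  concatMap (children key ∘ map h) L             ≡⟨ concatMap-cong children-map L ⟩
  concatMap (map (map h) ∘ children key′) L      ≡⟨ map-concatMap (map h) (children key′) L ⟨
  map (map h) (concatMap (children key′) L)      ∎
  where
  open ≡-Reasoning
  children : ∀ {Z : Set} → (Z → ℕ) → List Z → List (List Z)
  children κ cs = map (λ j → filter (λ x → κ x ≟ j) cs) (upTo k)
  filter-map-key : ∀ j cs → filter (λ y → key y ≟ j) (map h cs) ≡ map h (filter (λ x → key′ x ≟ j) cs)
  filter-map-key j cs = trans (filter-map (λ y → key y ≟ j) h cs)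
    (cong (map h) (filter-≐ _ _ ((λ p → trans (sym (key∘h≡key′ _)) p) , (λ p → trans (key∘h≡key′ _) p)) cs))
  children-map : ∀ cs → children key (map h cs) ≡ map (map h) (children key′ cs)
  children-map cs = trans (map-cong (λ j → filter-map-key j cs) (upTo k)) (map-∘ (upTo k))

module _ (key : X → ℕ) (a : ℕ) where
  private
    below below-suc : Decidable (λ x → key x < _)
    below x = key x <? a
    below-suc x = key x <? suc a
    at : Decidable (λ x → key x ≡ a)
    at x = key x ≟ a

  filter-<-suc-↭ : ∀ cs → filter below-suc cs ↭ filter below cs ++ filter at cs
  filter-<-suc-↭ []       = ↭-refl
  filter-<-suc-↭ (c ∷ cs) with <-cmp (key c) a
  ... | tri< c<a c≢a _ = begin
    filter below-suc (c ∷ cs)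
      ≡⟨ filter-accept below-suc (m<n⇒m<1+n c<a) ⟩
    c ∷ filter below-suc cs
      ↭⟨ prep c (filter-<-suc-↭ cs) ⟩
    c ∷ filter below cs ++ filter at cs
      ≡⟨ cong₂ _++_ (filter-accept below c<a) (filter-reject at c≢a) ⟨
    filter below (c ∷ cs) ++ filter at (c ∷ cs) ∎
    where open PermutationReasoning
  ... | tri≈ c≮a c≡a _ = begin
    filter below-suc (c ∷ cs)
      ≡⟨ filter-accept below-suc (≤-reflexive (cong suc c≡a)) ⟩
    c ∷ filter below-suc cs
      ↭⟨ prep c (filter-<-suc-↭ cs) ⟩
    c ∷ filter below cs ++ filter at cs
      ↭⟨ shift c (filter below cs) (filter at cs) ⟨
    filter below cs ++ c ∷ filter at cs
      ≡⟨ cong₂ _++_ (filter-reject below c≮a) (filter-accept at c≡a) ⟨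
    filter below (c ∷ cs) ++ filter at (c ∷ cs) ∎
    where open PermutationReasoning
  ... | tri> _ c≢a a<c = begin
    filter below-suc (c ∷ cs)
      ≡⟨ filter-reject below-suc (λ c<1+a → <⇒≱ a<c (m<1+n⇒m≤n c<1+a)) ⟩
    filter below-suc cs
      ↭⟨ filter-<-suc-↭ cs ⟩
    filter below cs ++ filter at cs
      ≡⟨ cong₂ _++_ (filter-reject below (<-asym a<c)) (filter-reject at c≢a) ⟨
    filter below (c ∷ cs) ++ filter at (c ∷ cs) ∎
    where open PermutationReasoning

concat-children-↭ : ∀ {X : Set} (key : X → ℕ) a cs →
  concat (map (λ j → filter (λ x → key x ≟ j) cs) (upTo a)) ↭ filter (λ x → key x <? a) cs
concat-children-↭ key zero    cs = ↭-reflexive (sym (filter-none (λ x → key x <? 0) (All.universal (λ _ → n≮0) cs)))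
concat-children-↭ {X} key (suc a) cs = begin
  concat (map child (upTo (suc a)))
    ≡⟨ cong (concat ∘ map child) (upTo-∷ʳ a) ⟨
  concat (map child (upTo a ++ a ∷ []))
    ≡⟨ cong concat (map-++ child (upTo a) (a ∷ [])) ⟩
  concat (map child (upTo a) ++ child a ∷ [])
    ≡⟨ concat-++ (map child (upTo a)) (child a ∷ []) ⟨
  concat (map child (upTo a)) ++ child a ++ []
    ≡⟨ cong (concat (map child (upTo a)) ++_) (++-identityʳ (child a)) ⟩
  concat (map child (upTo a)) ++ child a
    ↭⟨ ++⁺ (concat-children-↭ key a cs) ↭-refl ⟩
  filter (λ x → key x <? a) cs ++ child a
    ↭⟨ filter-<-suc-↭ key a cs ⟨
  filter (λ x → key x <? suc a) cs ∎
  where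
  open PermutationReasoning
  child : ℕ → List X
  child j = filter (λ x → key x ≟ j) cs

fire-↭ : ∀ {X : Set} k (key : X → ℕ) → (∀ x → key x < k) → ∀ L → concat (fire k key L) ↭ concat L
fire-↭ k key key<k []       = ↭-refl
fire-↭ {X} k key key<k (cs ∷ L) = begin
  concat (children ++ fire k key L)
    ≡⟨ concat-++ children (fire k key L) ⟨
  concat children ++ concat (fire k key L)
    ↭⟨ ++⁺ (concat-children-↭ key k cs) (fire-↭ k key key<k L) ⟩
  filter (λ x → key x <? k) cs ++ concat L
    ≡⟨ cong (_++ concat L) (filter-all (λ x → key x <? k) (All.universal key<k cs)) ⟩
  cs ++ concat L ∎
  where
  open PermutationReasoning
  children : List (List X)
  children = map (λ j → filter (λ x → key x ≟ j) cs) (upTo k)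

module _ {I : Set} (k : ℕ) where

  fireAll-map : ∀ {key : I → Y → ℕ} {key′ : I → X → ℕ} (h : X → Y) → (∀ i x → key i (h x) ≡ key′ i x) →
    ∀ L is → fireAll k key (map (map h) L) is ≡ map (map h) (fireAll k key′ L is)
  fireAll-map h key∘h≡key′ L []       = refl
  fireAll-map {key = key} h key∘h≡key′ L (i ∷ is) = trans
    (cong (λ L′ → fireAll k key L′ is) (fire-map k h (key∘h≡key′ i) L))
    (fireAll-map h key∘h≡key′ _ is)

  fireAll-++ : ∀ (key : I → X → ℕ) L L′ is → fireAll k key (L ++ L′) is ≡ fireAll k key L is ++ fireAll k key L′ is
  fireAll-++ key L L′ []       = refl
  fireAll-++ key L L′ (i ∷ is) = trans
    (cong (λ M → fireAll k key M is) (concatMap-++ _ L L′))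
    (fireAll-++ key (fire k (key i) L) (fire k (key i) L′) is)

  fireAll-[] : ∀ (key : I → X → ℕ) is → fireAll k key [] is ≡ []
  fireAll-[] key []       = refl
  fireAll-[] key (i ∷ is) = fireAll-[] key is

  fireAll-vertexwise : ∀ (key : I → X → ℕ) L is → fireAll k key L is ≡ concatMap (λ cs → fireAll k key (cs ∷ []) is) L
  fireAll-vertexwise key []       is = fireAll-[] key is
  fireAll-vertexwise key (cs ∷ L) is = trans
    (fireAll-++ key (cs ∷ []) L is)
    (cong (fireAll k key (cs ∷ []) is ++_) (fireAll-vertexwise key L is))

  fireAll-↭ : ∀ (key : I → X → ℕ) → (∀ i x → key i x < k) → ∀ L is → concat (fireAll k key L is) ↭ concat L
  fireAll-↭ key key<k L []       = ↭-refl
  fireAll-↭ key key<k L (i ∷ is) = ↭-trans (fireAll-↭ key key<k (fire k (key i) L) is) (fire-↭ k (key i) (key<k i) L)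

-- Chips as digit words

Word : ℕ → ℕ → Set
Word k n = Vec (Fin k) n

value : ∀ {k n} → Word k n → ℕ
value               []      = 0
value {k} {suc n} (d ∷ u) = toℕ d * k ^ n + value u

value< : ∀ {k n} (u : Word k n) → value u < k ^ n
value<             []      = s≤s z≤n
value< {k} {suc n} (d ∷ u) = begin-strict
  toℕ d * k ^ n + value u   <⟨ +-monoʳ-< (toℕ d * k ^ n) (value< u) ⟩
  toℕ d * k ^ n + k ^ n     ≡⟨ +-comm (toℕ d * k ^ n) (k ^ n) ⟩
  suc (toℕ d) * k ^ n       ≤⟨ *-monoˡ-≤ (k ^ n) (toℕ<n d) ⟩
  k * k ^ n                 ∎
  where open ≤-Reasoning

prependDigits : ∀ {k n} → List (Word k n) → List (Word k (suc n))
prependDigits {k} U = concatMap (λ d → map (d ∷_) U) (allFin k)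

words : (k n : ℕ) → List (Word k n)
words k zero    = [] ∷ []
words k (suc n) = prependDigits (words k n)

map-value-prependDigits : ∀ {k n} (U : List (Word k n)) → map value (prependDigits U) ≡ shiftedCopies (k ^ n) k (map value U)
map-value-prependDigits {k} {n} U = begin
  map value (concatMap (λ d → map (d ∷_) U) (allFin k))
    ≡⟨ map-concatMap value (λ d → map (d ∷_) U) (allFin k) ⟩
  concatMap (λ d → map value (map (d ∷_) U)) (allFin k)
    ≡⟨ concatMap-cong (λ d → trans (sym (map-∘ U)) (map-∘ U)) (allFin k) ⟩
  concatMap (λ d → map (toℕ d * k ^ n +_) (map value U)) (allFin k)
    ≡⟨ concatMap-map (λ d → map (d * k ^ n +_) (map value U)) toℕ (allFin k) ⟨
  concatMap (λ d → map (d * k ^ n +_) (map value U)) (map toℕ (allFin k))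
    ≡⟨ cong (concatMap _) (map-toℕ-allFin k) ⟩
  shiftedCopies (k ^ n) k (map value U) ∎
  where open ≡-Reasoning

map-value-words : ∀ k n → map value (words k n) ≡ upTo (k ^ n)
map-value-words k zero    = refl
map-value-words k (suc n) = begin
  map value (prependDigits (words k n))           ≡⟨ map-value-prependDigits (words k n) ⟩
  shiftedCopies (k ^ n) k (map value (words k n)) ≡⟨ cong (shiftedCopies (k ^ n) k) (map-value-words k n) ⟩
  shiftedCopies (k ^ n) k (upTo (k ^ n))          ≡⟨ upTo-* k (k ^ n) ⟨
  upTo (k ^ suc n)                                ∎
  where open ≡-Reasoning

[m*n+r]/n≡m+r/n : ∀ m n r .{{_ : NonZero n}} → (m * n + r) / n ≡ m + r / n
[m*n+r]/n≡m+r/n m n r = trans (+-distrib-/-∣ˡ r (divides-refl m)) (cong (_+ r / n) (m*n/n≡m m n))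

digit-value : ∀ {k N} (u : Word (suc k) N) (m : Fin N) → digit (suc k) N (toℕ m) (value u) ≡ toℕ (lookup u m)
digit-value {k} {suc N} (d ∷ u) Fin.zero = begin
  ((toℕ d * K ^ N + value u) / K ^ N) % K  ≡⟨ cong (_% K) ([m*n+r]/n≡m+r/n (toℕ d) (K ^ N) (value u)) ⟩
  (toℕ d + value u / K ^ N) % K            ≡⟨ cong (λ q → (toℕ d + q) % K) (m<n⇒m/n≡0 (value< u)) ⟩
  (toℕ d + 0) % K                          ≡⟨ cong (_% K) (+-identityʳ (toℕ d)) ⟩
  toℕ d % K                                ≡⟨ m<n⇒m%n≡m (toℕ<n d) ⟩
  toℕ d                                    ∎
  where
  open ≡-Reasoning
  K = suc k
  instance
    _ : NonZero (K ^ N)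
    _ = m^n≢0 K N
digit-value {k} {suc N} (d ∷ u) (Fin.suc m) = begin
  ((toℕ d * K ^ N + value u) / P) % K    ≡⟨ cong (λ x → ((x + value u) / P) % K) split-power ⟩
  ((Q * K * P + value u) / P) % K        ≡⟨ cong (_% K) ([m*n+r]/n≡m+r/n (Q * K) P (value u)) ⟩
  (Q * K + value u / P) % K              ≡⟨ cong (_% K) (+-comm (Q * K) (value u / P)) ⟩
  (value u / P + Q * K) % K              ≡⟨ [m+kn]%n≡m%n (value u / P) Q K ⟩
  (value u / P) % K                      ≡⟨ digit-value u m ⟩
  toℕ (lookup u m)                       ∎
  where
  open ≡-Reasoning
  K = suc k
  e = N ∸ suc (toℕ m)
  P = K ^ e
  instance
    _ : NonZero P
    _ = m^n≢0 K e
  Q = toℕ d * K ^ toℕ m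
  split-power : toℕ d * K ^ N ≡ Q * K * P
  split-power = begin
    toℕ d * K ^ N                       ≡⟨ cong (λ j → toℕ d * K ^ j) (m+[n∸m]≡n (toℕ<n m)) ⟨
    toℕ d * K ^ (suc (toℕ m) + e)       ≡⟨ cong (toℕ d *_) (^-distribˡ-+-* K (suc (toℕ m)) e) ⟩
    toℕ d * (K * K ^ toℕ m * P)         ≡⟨ rearrange (toℕ d) K (K ^ toℕ m) P ⟩
    Q * K * P                           ∎
    where
    rearrange : ∀ a b c p → a * (b * c * p) ≡ a * c * b * p
    rearrange = solve-∀

insertDigit : ∀ {k n} → Fin (suc n) → Fin k → Word k n → Word k (suc n)
insertDigit m f u = insertAt u m f

value-leading-< : ∀ {k n} {d e : Fin k} (u v : Word k n) → toℕ d < toℕ e → value (d ∷ u) < value (e ∷ v)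
value-leading-< {k} {n} {d} {e} u v d<e = begin-strict
  toℕ d * k ^ n + value u   <⟨ +-monoʳ-< (toℕ d * k ^ n) (value< u) ⟩
  toℕ d * k ^ n + k ^ n     ≡⟨ +-comm (toℕ d * k ^ n) (k ^ n) ⟩
  suc (toℕ d) * k ^ n       ≤⟨ *-monoˡ-≤ (k ^ n) d<e ⟩
  toℕ e * k ^ n             ≤⟨ m≤m+n (toℕ e * k ^ n) (value v) ⟩
  toℕ e * k ^ n + value v   ∎
  where open ≤-Reasoning

value-∷-< : ∀ {k n} (d e : Fin k) (u v : Word k n) →
  value (d ∷ u) < value (e ∷ v) ⇔ (toℕ d < toℕ e ⊎ (d ≡ e × value u < value v))
value-∷-< {k} {n} d e u v = mk⇔ compare lexicographic
  where
  compare : value (d ∷ u) < value (e ∷ v) → toℕ d < toℕ e ⊎ (d ≡ e × value u < value v)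
  compare du<ev with <-cmp (toℕ d) (toℕ e)
  ... | tri< d<e _ _ = inj₁ d<e
  ... | tri≈ _ d≡e _ rewrite toℕ-injective d≡e = inj₂ (refl , +-cancelˡ-< (toℕ e * k ^ n) (value u) (value v) du<ev)
  ... | tri> _ _ e<d = contradiction du<ev (<-asym (value-leading-< v u e<d))
  lexicographic : toℕ d < toℕ e ⊎ (d ≡ e × value u < value v) → value (d ∷ u) < value (e ∷ v)
  lexicographic (inj₁ d<e)          = value-leading-< u v d<e
  lexicographic (inj₂ (refl , u<v)) = +-monoʳ-< (toℕ d * k ^ n) u<v

insertDigit-sameOrder : ∀ {k n} (m : Fin (suc n)) (f : Fin k) → SameOrder (value ∘ insertDigit m f) value
insertDigit-sameOrder {k} {n} Fin.zero f u v =
  mk⇔ (+-cancelˡ-< (toℕ f * k ^ n) (value u) (value v)) (+-monoʳ-< (toℕ f * k ^ n))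
insertDigit-sameOrder (Fin.suc m) f (d ∷ u) (e ∷ v) =
  ⇔.trans (value-∷-< d e (insertDigit m f u) (insertDigit m f v))
    (⇔.trans (⇔.refl ⊎-⇔ (⇔.refl ×-⇔ insertDigit-sameOrder m f u v)) (⇔.sym (value-∷-< d e u v)))

hasDigit : ∀ {k n} (m : Fin n) (j : ℕ) → Decidable (λ (u : Word k n) → toℕ (lookup u m) ≡ j)
hasDigit m j u = toℕ (lookup u m) ≟ j

module _ {k n : ℕ} where

  filter-leadingDigit : ∀ (U : List (Word k n)) f → filter (hasDigit Fin.zero (toℕ f)) (prependDigits U) ≡ map (f ∷_) U
  filter-leadingDigit U f = begin
    filter (hasDigit Fin.zero (toℕ f)) (prependDigits U)
      ≡⟨ filter-concatMap (hasDigit Fin.zero (toℕ f)) _ (allFin k) ⟩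
    concatMap (λ d → filter (hasDigit Fin.zero (toℕ f)) (map (d ∷_) U)) (allFin k)
      ≡⟨ concatMap-allFin-single _ f other-digit ⟩
    filter (hasDigit Fin.zero (toℕ f)) (map (f ∷_) U)
      ≡⟨ filter-map (hasDigit Fin.zero (toℕ f)) (f ∷_) U ⟩
    map (f ∷_) (filter (λ _ → toℕ f ≟ toℕ f) U)
      ≡⟨ cong (map (f ∷_)) (filter-all (λ _ → toℕ f ≟ toℕ f) (All.universal (λ _ → refl) U)) ⟩
    map (f ∷_) U ∎
    where
    open ≡-Reasoning
    other-digit : ∀ d → d ≢ f → filter (hasDigit Fin.zero (toℕ f)) (map (d ∷_) U) ≡ []
    other-digit d d≢f = trans (filter-map (hasDigit Fin.zero (toℕ f)) (d ∷_) U)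
      (cong (map (d ∷_)) (filter-none (λ _ → toℕ d ≟ toℕ f) (All.universal (λ _ → d≢f ∘ toℕ-injective) U)))

  filter-prependDigits : ∀ (U : List (Word k n)) m j →
    filter (hasDigit (Fin.suc m) j) (prependDigits U) ≡ prependDigits (filter (hasDigit m j) U)
  filter-prependDigits U m j = trans (filter-concatMap (hasDigit (Fin.suc m) j) _ (allFin k))
    (concatMap-cong (λ d → filter-map (hasDigit (Fin.suc m) j) (d ∷_) U) (allFin k))

  map-insertDigit-prependDigits : ∀ (U : List (Word k n)) m f →
    map (insertDigit (Fin.suc m) f) (prependDigits U) ≡ prependDigits (map (insertDigit m f) U)
  map-insertDigit-prependDigits U m f = trans (map-concatMap (insertDigit (Fin.suc m) f) _ (allFin k))
    (concatMap-cong (λ d → trans (sym (map-∘ U)) (map-∘ U)) (allFin k))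

filter-words-hasDigit : ∀ k n (m : Fin (suc n)) (f : Fin k) →
  filter (hasDigit m (toℕ f)) (words k (suc n)) ≡ map (insertDigit m f) (words k n)
filter-words-hasDigit k n           Fin.zero    f = filter-leadingDigit (words k n) f
filter-words-hasDigit k (suc n) (Fin.suc m) f = begin
  filter (hasDigit (Fin.suc m) (toℕ f)) (prependDigits (words k (suc n)))
    ≡⟨ filter-prependDigits (words k (suc n)) m (toℕ f) ⟩
  prependDigits (filter (hasDigit m (toℕ f)) (words k (suc n)))
    ≡⟨ cong prependDigits (filter-words-hasDigit k n m f) ⟩
  prependDigits (map (insertDigit m f) (words k n))
    ≡⟨ map-insertDigit-prependDigits (words k n) m f ⟨
  map (insertDigit (Fin.suc m) f) (words k (suc n)) ∎
  where open ≡-Reasoning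

-- Firing digit words

wordKey : ∀ {k n} → Permutation′ n → Fin n → Word k n → ℕ
wordKey w i u = toℕ (lookup u (w ⟨$⟩ʳ i))

wordLayer : (k n : ℕ) → Permutation′ n → List (List (Word k n))
wordLayer k n w = fireAll k (wordKey w) (words k n ∷ []) (allFin n)

finalLayer-value : ∀ k n (w : Permutation′ n) → finalLayer (suc k) n w ≡ map (map value) (wordLayer (suc k) n w)
finalLayer-value k n w = begin
  fireAll (suc k) digitKey (upTo (suc k ^ n) ∷ []) (allFin n)
    ≡⟨ cong (λ L → fireAll (suc k) digitKey (L ∷ []) (allFin n)) (map-value-words (suc k) n) ⟨
  fireAll (suc k) digitKey (map (map value) (words (suc k) n ∷ [])) (allFin n)
    ≡⟨ fireAll-map (suc k) value (λ i u → digit-value u (w ⟨$⟩ʳ i)) (words (suc k) n ∷ []) (allFin n) ⟩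
  map (map value) (wordLayer (suc k) n w) ∎
  where
  open ≡-Reasoning
  digitKey : Fin n → ℕ → ℕ
  digitKey i = digit (suc k) n (toℕ (w ⟨$⟩ʳ i))

wordInversions : (k n : ℕ) → Permutation′ n → ℕ
wordInversions k n w = inversions (map value (concat (wordLayer k n w)))

I≡wordInversions : ∀ k n (w : Permutation′ n) → I (suc k) n w ≡ wordInversions (suc k) n w
I≡wordInversions k n w = cong inversions (trans (cong concat (finalLayer-value k n w)) (concat-map (wordLayer (suc k) n w)))

wordKey-insertDigit : ∀ {k n} (w : Permutation′ (suc n)) f i (u : Word k n) →
  wordKey w (Fin.suc i) (insertDigit (w ⟨$⟩ʳ Fin.zero) f u) ≡ wordKey (remove Fin.zero w) i u
wordKey-insertDigit w f i u = cong toℕ (trans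
  (cong (lookup (insertDigit (w ⟨$⟩ʳ Fin.zero) f u)) (punchIn-permute w Fin.zero i))
  (insertAt-punchIn u (w ⟨$⟩ʳ Fin.zero) f (remove Fin.zero w ⟨$⟩ʳ i)))

wordLayer-suc : ∀ k n (w : Permutation′ (suc n)) →
  wordLayer k (suc n) w
    ≡ concatMap (λ f → map (map (insertDigit (w ⟨$⟩ʳ Fin.zero) f)) (wordLayer k n (remove Fin.zero w))) (allFin k)
wordLayer-suc k n w = begin
  fireAll k key (words k (suc n) ∷ []) (allFin (suc n))
    ≡⟨ cong (fireAll k key (words k (suc n) ∷ [])) (allFin-suc n) ⟩
  fireAll k key (words k (suc n) ∷ []) (Fin.zero ∷ map Fin.suc (allFin n))
    ≡⟨ foldl-map _ Fin.suc _ (allFin n) ⟩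
  fireAll k (key ∘ Fin.suc) (fire k (key Fin.zero) (words k (suc n) ∷ [])) (allFin n)
    ≡⟨ cong (λ L → fireAll k (key ∘ Fin.suc) L (allFin n)) first-firing ⟩
  fireAll k (key ∘ Fin.suc) (map block (allFin k)) (allFin n)
    ≡⟨ fireAll-vertexwise k (key ∘ Fin.suc) (map block (allFin k)) (allFin n) ⟩
  concatMap (λ cs → fireAll k (key ∘ Fin.suc) (cs ∷ []) (allFin n)) (map block (allFin k))
    ≡⟨ concatMap-map _ block (allFin k) ⟩
  concatMap (λ f → fireAll k (key ∘ Fin.suc) (map (map (ins f)) (words k n ∷ [])) (allFin n)) (allFin k)
    ≡⟨ concatMap-cong (λ f → fireAll-map k (ins f) (wordKey-insertDigit w f) (words k n ∷ []) (allFin n)) (allFin k) ⟩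
  concatMap (λ f → map (map (ins f)) (wordLayer k n (remove Fin.zero w))) (allFin k) ∎
  where
  open ≡-Reasoning
  key = wordKey w
  ins = insertDigit (w ⟨$⟩ʳ Fin.zero)
  block : Fin k → List (Word k (suc n))
  block f = map (ins f) (words k n)
  first-firing : fire k (key Fin.zero) (words k (suc n) ∷ []) ≡ map block (allFin k)
  first-firing = begin
    map child (upTo k) ++ []           ≡⟨ ++-identityʳ (map child (upTo k)) ⟩
    map child (upTo k)                 ≡⟨ cong (map child) (map-toℕ-allFin k) ⟨
    map child (map toℕ (allFin k))     ≡⟨ map-∘ (allFin k) ⟨
    map (child ∘ toℕ) (allFin k)       ≡⟨ map-cong (filter-words-hasDigit k n (w ⟨$⟩ʳ Fin.zero)) (allFin k) ⟩
    map block (allFin k)               ∎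
    where
    child : ℕ → List (Word k (suc n))
    child j = filter (hasDigit (w ⟨$⟩ʳ Fin.zero) j) (words k (suc n))

wordLayer-↭ : ∀ k n (w : Permutation′ n) → concat (wordLayer k n w) ↭ words k n
wordLayer-↭ k n w = ↭-trans
  (fireAll-↭ k (wordKey w) (λ i u → toℕ<n (lookup u (w ⟨$⟩ʳ i))) (words k n ∷ []) (allFin n))
  (↭-reflexive (++-identityʳ (words k n)))

insertionBlocks : (k n : ℕ) → Fin (suc n) → List (List ℕ)
insertionBlocks k n m = map (λ f → map value (map (insertDigit m f) (words k n))) (allFin k)

wordInversions-suc : ∀ k n (w : Permutation′ (suc n)) →
  wordInversions k (suc n) w
    ≡ k * wordInversions k n (remove Fin.zero w) + blockCrossings (insertionBlocks k n (w ⟨$⟩ʳ Fin.zero))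
wordInversions-suc k n w = begin
  inversions (map value (concat (wordLayer k (suc n) w)))
    ≡⟨ cong (inversions ∘ map value) layer-concat ⟩
  inversions (map value (concatMap (λ f → map (ins f) C) (allFin k)))
    ≡⟨ cong inversions (map-concatMap value (λ f → map (ins f) C) (allFin k)) ⟩
  inversions (concat (map block (allFin k)))
    ≡⟨ inversions-concat (map block (allFin k)) ⟩
  sum (map inversions (map block (allFin k))) + blockCrossings (map block (allFin k))
    ≡⟨ cong₂ _+_ (cong sum block-inversions) (blockCrossings-cong-↭ block-↭ (allFin k)) ⟩
  sum (map (λ _ → wordInversions k n w′) (allFin k)) + blockCrossings (insertionBlocks k n m)
    ≡⟨ cong (_+ blockCrossings (insertionBlocks k n m)) (sum-map-const _ (allFin k)) ⟩
  length (allFin k) * wordInversions k n w′ + blockCrossings (insertionBlocks k n m)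
    ≡⟨ cong (λ l → l * wordInversions k n w′ + blockCrossings (insertionBlocks k n m)) (length-tabulate {n = k} (λ f → f)) ⟩
  k * wordInversions k n w′ + blockCrossings (insertionBlocks k n m) ∎
  where
  open ≡-Reasoning
  m = w ⟨$⟩ʳ Fin.zero
  w′ = remove Fin.zero w
  ins = insertDigit m
  C = concat (wordLayer k n w′)
  block : Fin k → List ℕ
  block f = map value (map (ins f) C)
  layer-concat : concat (wordLayer k (suc n) w) ≡ concatMap (λ f → map (ins f) C) (allFin k)
  layer-concat = begin
    concat (wordLayer k (suc n) w)
      ≡⟨ cong concat (wordLayer-suc k n w) ⟩
    concat (concat (map (λ f → map (map (ins f)) (wordLayer k n w′)) (allFin k)))
      ≡⟨ concat-concat (map (λ f → map (map (ins f)) (wordLayer k n w′)) (allFin k)) ⟨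
    concat (map concat (map (λ f → map (map (ins f)) (wordLayer k n w′)) (allFin k)))
      ≡⟨ cong concat (map-∘ (allFin k)) ⟨
    concatMap (λ f → concat (map (map (ins f)) (wordLayer k n w′))) (allFin k)
      ≡⟨ concatMap-cong (λ f → concat-map (wordLayer k n w′)) (allFin k) ⟩
    concatMap (λ f → map (ins f) C) (allFin k) ∎
  block-inversions : map inversions (map block (allFin k)) ≡ map (λ _ → wordInversions k n w′) (allFin k)
  block-inversions = trans (sym (map-∘ (allFin k))) (map-cong (λ f → trans (cong inversions (sym (map-∘ C)))
    (inversions-sameOrder (insertDigit-sameOrder m f) C)) (allFin k))
  block-↭ : ∀ f → block f ↭ map value (map (ins f) (words k n))
  block-↭ f = map⁺ value (map⁺ (ins f) (wordLayer-↭ k n w′))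

blockCrossings-insertionBlocks-zero : ∀ k n → blockCrossings (insertionBlocks k n Fin.zero) ≡ 0
blockCrossings-insertionBlocks-zero k n = m+n≡0⇒n≡0 (sum (map inversions (insertionBlocks k n Fin.zero))) (begin
  sum (map inversions (insertionBlocks k n Fin.zero)) + blockCrossings (insertionBlocks k n Fin.zero)
    ≡⟨ inversions-concat (insertionBlocks k n Fin.zero) ⟨
  inversions (concat (insertionBlocks k n Fin.zero))
    ≡⟨ cong inversions (map-concatMap value (λ f → map (f ∷_) (words k n)) (allFin k)) ⟨
  inversions (map value (words k (suc n)))
    ≡⟨ cong inversions (map-value-words k (suc n)) ⟩
  inversions (upTo (k ^ suc n))
    ≡⟨ inversions-upTo (k ^ suc n) ⟩
  0 ∎)
  where open ≡-Reasoning

insertionBlocks-suc : ∀ k n (m : Fin (suc n)) →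
  insertionBlocks k (suc n) (Fin.suc m) ≡ map (shiftedCopies (k ^ suc n) k) (insertionBlocks k n m)
insertionBlocks-suc k n m = trans (map-cong shifted (allFin k)) (map-∘ (allFin k))
  where
  shifted : ∀ f → map value (map (insertDigit (Fin.suc m) f) (words k (suc n)))
                  ≡ shiftedCopies (k ^ suc n) k (map value (map (insertDigit m f) (words k n)))
  shifted f = trans (cong (map value) (map-insertDigit-prependDigits (words k n) m f))
                    (map-value-prependDigits (map (insertDigit m f) (words k n)))

map-length-insertionBlocks : ∀ k n m → map length (insertionBlocks k n m) ≡ map (λ _ → length (words k n)) (allFin k)
map-length-insertionBlocks k n m = trans (sym (map-∘ (allFin k)))
  (map-cong (λ f → trans (length-map value (map (insertDigit m f) (words k n)))
                         (length-map (insertDigit m f) (words k n))) (allFin k))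

insertionBlocks-< : ∀ k n m → All (All (_< k ^ suc n)) (insertionBlocks k n m)
insertionBlocks-< k n m =
  All.map⁺ (All.universal (λ f → All.map⁺ (All.universal value< (map (insertDigit m f) (words k n)))) (allFin k))

blockCrossings-insertionBlocks-suc : ∀ k n (m : Fin (suc n)) →
  blockCrossings (insertionBlocks k (suc n) (Fin.suc m))
    ≡ k * blockCrossings (insertionBlocks k n m) + (k C 2) * blockPairs (map (λ _ → length (words k n)) (allFin k))
blockCrossings-insertionBlocks-suc k n m = begin
  blockCrossings (insertionBlocks k (suc n) (Fin.suc m))
    ≡⟨ cong blockCrossings (insertionBlocks-suc k n m) ⟩
  blockCrossings (map (shiftedCopies (k ^ suc n) k) (insertionBlocks k n m))
    ≡⟨ blockCrossings-shiftedCopies (k ^ suc n) k (insertionBlocks k n m) (insertionBlocks-< k n m) ⟩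
  k * blockCrossings (insertionBlocks k n m) + (k C 2) * blockPairs (map length (insertionBlocks k n m))
    ≡⟨ cong (λ ls → k * blockCrossings (insertionBlocks k n m) + (k C 2) * blockPairs ls) (map-length-insertionBlocks k n m) ⟩
  k * blockCrossings (insertionBlocks k n m) + (k C 2) * blockPairs (map (λ _ → length (words k n)) (allFin k)) ∎
  where open ≡-Reasoning

blockCrossings-insertionBlocks-mono : ∀ k n {m m′ : Fin (suc n)} → toℕ m ≤ toℕ m′ →
  blockCrossings (insertionBlocks k n m) ≤ blockCrossings (insertionBlocks k n m′)
blockCrossings-insertionBlocks-mono k n {Fin.zero} _ = ≤-trans (≤-reflexive (blockCrossings-insertionBlocks-zero k n)) z≤n
blockCrossings-insertionBlocks-mono k (suc n) {Fin.suc m} {Fin.suc m′} (s≤s m≤m′) = begin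
  blockCrossings (insertionBlocks k (suc n) (Fin.suc m))
    ≡⟨ blockCrossings-insertionBlocks-suc k n m ⟩
  k * blockCrossings (insertionBlocks k n m) + pairs
    ≤⟨ +-monoˡ-≤ pairs (*-monoʳ-≤ k (blockCrossings-insertionBlocks-mono k n m≤m′)) ⟩
  k * blockCrossings (insertionBlocks k n m′) + pairs
    ≡⟨ blockCrossings-insertionBlocks-suc k n m′ ⟨
  blockCrossings (insertionBlocks k (suc n) (Fin.suc m′)) ∎
  where
  open ≤-Reasoning
  pairs = (k C 2) * blockPairs (map (λ _ → length (words k n)) (allFin k))

-- Lehmer codes

indicator : ∀ {P : Set} → Dec P → ℕ
indicator P? = if does P? then 1 else 0

length-filter-∷ : ∀ {P : Pred X 0ℓ} (P? : Decidable P) x xs →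
  length (filter P? (x ∷ xs)) ≡ indicator (P? x) + length (filter P? xs)
length-filter-∷ P? x xs with does (P? x)
... | true  = refl
... | false = refl

length-filter-allFin : ∀ {n} {P : Pred (Fin n) 0ℓ} (P? : Decidable P) →
  length (filter P? (allFin n)) ≡ ∑[ j < n ] indicator (P? j)
length-filter-allFin {zero}  P? = refl
length-filter-allFin {suc n} P? = begin
  length (filter P? (allFin (suc n)))
    ≡⟨ cong (length ∘ filter P?) (allFin-suc n) ⟩
  length (filter P? (Fin.zero ∷ map Fin.suc (allFin n)))
    ≡⟨ length-filter-∷ P? Fin.zero (map Fin.suc (allFin n)) ⟩
  indicator (P? Fin.zero) + length (filter P? (map Fin.suc (allFin n)))
    ≡⟨ cong (indicator (P? Fin.zero) +_) (length-filter-map P? Fin.suc (allFin n)) ⟩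
  indicator (P? Fin.zero) + length (filter (P? ∘ Fin.suc) (allFin n))
    ≡⟨ cong (indicator (P? Fin.zero) +_) (length-filter-allFin (P? ∘ Fin.suc)) ⟩
  ∑[ j < suc n ] indicator (P? j) ∎
  where open ≡-Reasoning

∑-indicator-< : ∀ {n} (c : Fin n) → ∑[ a < n ] indicator (a <ᶠ? c) ≡ toℕ c
∑-indicator-< {suc n} Fin.zero    = sum-replicate-zero n
∑-indicator-< {suc n} (Fin.suc c) = cong suc (∑-indicator-< c)

length-filter-permute-< : ∀ {n} (w : Permutation′ n) (c : Fin n) →
  length (filter (λ j → (w ⟨$⟩ʳ j) <ᶠ? c) (allFin n)) ≡ toℕ c
length-filter-permute-< {n} w c = begin
  length (filter (λ j → (w ⟨$⟩ʳ j) <ᶠ? c) (allFin n))  ≡⟨ length-filter-allFin (λ j → (w ⟨$⟩ʳ j) <ᶠ? c) ⟩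
  ∑[ j < n ] indicator ((w ⟨$⟩ʳ j) <ᶠ? c)              ≡⟨ ∑-permute (λ a → indicator (a <ᶠ? c)) w ⟨
  ∑[ a < n ] indicator (a <ᶠ? c)                       ≡⟨ ∑-indicator-< c ⟩
  toℕ c                                                ∎
  where open ≡-Reasoning

lehmer-zero : ∀ {n} (w : Permutation′ (suc n)) → lehmer w Fin.zero ≡ toℕ (w ⟨$⟩ʳ Fin.zero)
lehmer-zero {n} w = trans
  (cong length (filter-≐ inversion? below-head? (proj₂ , λ {j} wj<w0 → positive j wj<w0 , wj<w0) (allFin (suc n))))
  (length-filter-permute-< w (w ⟨$⟩ʳ Fin.zero))
  where
  inversion? = λ j → (Fin.zero {n} <ᶠ? j) ×-dec ((w ⟨$⟩ʳ j) <ᶠ? (w ⟨$⟩ʳ Fin.zero))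
  below-head? = λ j → (w ⟨$⟩ʳ j) <ᶠ? (w ⟨$⟩ʳ Fin.zero)
  positive : ∀ j → (w ⟨$⟩ʳ j) <ᶠ (w ⟨$⟩ʳ Fin.zero) → Fin.zero {n} <ᶠ j
  positive Fin.zero    w0<w0 = contradiction w0<w0 (<-irrefl refl)
  positive (Fin.suc j) _     = s≤s z≤n

punchIn-<⇔ : ∀ {n} (p : Fin (suc n)) (a b : Fin n) → punchIn p a <ᶠ punchIn p b ⇔ a <ᶠ b
punchIn-<⇔ p a b = mk⇔
  (λ pa<pb → ≰⇒> (λ b≤a → <⇒≱ pa<pb (punchIn-mono-≤ p b a b≤a)))
  (λ a<b → ≰⇒> (λ pb≤pa → <⇒≱ a<b (punchIn-cancel-≤ p b a pb≤pa)))

lehmer-suc : ∀ {n} (w : Permutation′ (suc n)) i → lehmer w (Fin.suc i) ≡ lehmer (remove Fin.zero w) i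
lehmer-suc {n} w i = begin
  length (filter inversion? (allFin (suc n)))
    ≡⟨ cong (length ∘ filter inversion?) (allFin-suc n) ⟩
  length (filter inversion? (Fin.zero ∷ map Fin.suc (allFin n)))
    ≡⟨ cong length (filter-reject inversion? {xs = map Fin.suc (allFin n)} (λ (i<0 , _) → n≮0 i<0)) ⟩
  length (filter inversion? (map Fin.suc (allFin n)))
    ≡⟨ length-filter-map inversion? Fin.suc (allFin n) ⟩
  length (filter (inversion? ∘ Fin.suc) (allFin n))
    ≡⟨ cong length (filter-≐ (inversion? ∘ Fin.suc) inversion′? (Equivalence.to (same _) , Equivalence.from (same _)) (allFin n)) ⟩
  lehmer w′ i ∎
  where
  open ≡-Reasoning
  w′ = remove Fin.zero w
  inversion? = λ j → (Fin.suc i <ᶠ? j) ×-dec ((w ⟨$⟩ʳ j) <ᶠ? (w ⟨$⟩ʳ Fin.suc i))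
  inversion′? = λ j → (i <ᶠ? j) ×-dec ((w′ ⟨$⟩ʳ j) <ᶠ? (w′ ⟨$⟩ʳ i))
  values : ∀ j → (w ⟨$⟩ʳ Fin.suc j) <ᶠ (w ⟨$⟩ʳ Fin.suc i) ⇔ (w′ ⟨$⟩ʳ j) <ᶠ (w′ ⟨$⟩ʳ i)
  values j = subst₂ (λ a b → a <ᶠ b ⇔ (w′ ⟨$⟩ʳ j) <ᶠ (w′ ⟨$⟩ʳ i))
    (sym (punchIn-permute w Fin.zero j)) (sym (punchIn-permute w Fin.zero i))
    (punchIn-<⇔ (w ⟨$⟩ʳ Fin.zero) (w′ ⟨$⟩ʳ j) (w′ ⟨$⟩ʳ i))
  same : ∀ j → (Fin.suc i <ᶠ Fin.suc j × (w ⟨$⟩ʳ Fin.suc j) <ᶠ (w ⟨$⟩ʳ Fin.suc i))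
             ⇔ (i <ᶠ j × (w′ ⟨$⟩ʳ j) <ᶠ (w′ ⟨$⟩ʳ i))
  same j = mk⇔ s≤s⁻¹ s≤s ×-⇔ values j

wordInversions-mono : ∀ k {n} (w w′ : Permutation′ n) → (∀ i → lehmer w i ≤ lehmer w′ i) →
  wordInversions k n w ≤ wordInversions k n w′
wordInversions-mono k {zero}  w w′ _        = z≤n
wordInversions-mono k {suc n} w w′ code≤code = begin
  wordInversions k (suc n) w
    ≡⟨ wordInversions-suc k n w ⟩
  k * wordInversions k n (remove Fin.zero w) + blockCrossings (insertionBlocks k n (w ⟨$⟩ʳ Fin.zero))
    ≤⟨ +-mono-≤ (*-monoʳ-≤ k (wordInversions-mono k (remove Fin.zero w) (remove Fin.zero w′) tail≤tail))
                (blockCrossings-insertionBlocks-mono k n head≤head) ⟩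
  k * wordInversions k n (remove Fin.zero w′) + blockCrossings (insertionBlocks k n (w′ ⟨$⟩ʳ Fin.zero))
    ≡⟨ wordInversions-suc k n w′ ⟨
  wordInversions k (suc n) w′ ∎
  where
  open ≤-Reasoning
  head≤head : toℕ (w ⟨$⟩ʳ Fin.zero) ≤ toℕ (w′ ⟨$⟩ʳ Fin.zero)
  head≤head = subst₂ _≤_ (lehmer-zero w) (lehmer-zero w′) (code≤code Fin.zero)
  tail≤tail : ∀ i → lehmer (remove Fin.zero w) i ≤ lehmer (remove Fin.zero w′) i
  tail≤tail i = subst₂ _≤_ (lehmer-suc w i) (lehmer-suc w′ i) (code≤code (Fin.suc i))

theorem4p7 : (k n : ℕ) → 2 ≤ k → (w w′ : Permutation′ n) →
    ((i : Fin n) → lehmer w i ≤ lehmer w′ i) →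
    I k n w ≤ I k n w′
-- 2 ≤ k only serves to exclude k = 0, for which `digit` is a junk value.
theorem4p7 (suc k) n _ w w′ code≤code = begin
  I (suc k) n w               ≡⟨ I≡wordInversions k n w ⟩
  wordInversions (suc k) n w  ≤⟨ wordInversions-mono (suc k) w w′ code≤code ⟩
  wordInversions (suc k) n w′ ≡⟨ I≡wordInversions k n w′ ⟨
  I (suc k) n w′              ∎
  where open ≤-Reasoning
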